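{- Let $n$ be a positive integer with $n\neq 2$, and for each $1\leq i\leq\left\lfloor \frac{n-1}{3}\right\rfloor$ choose an index $j_i\in\{2i+1,\ldots,n-i\}$. Then a multi-symmetric Steinhaus matrix $M=(a_{i,j})$ of size $n$ is uniquely determined (among multi-symmetric Steinhaus matrices of size $n$) by the following entries: - if $n$ is even: $a_{1,j_1}$ and $a_{2i,j_{2i}}$ for $1\leq i\leq\left\lceil \frac{n}{6}\right\rceil-1$; - if $n$ is odd: $a_{2i+1,j_{2i+1}}$ for $0\leq i\leq\left\lceil \frac{n-3}{6}\right\rceil-1$.
   Context: A Steinhaus matrix of size $n\geq1$ is a matrix $M=(a_{i,j})_{1\leq i,j\leq n}$ with entries in $\mathbb{F}_2=\{0,1\}$ such that $a_{i,i}=0$ for all $i$, $a_{i,j}=a_{i-1,j-1}+a_{i-1,j}$ (addition in $\mathbb{F}_2$) for all $2\leq i<j\leq n$, and $a_{i,j}=a_{j,i}$ for all $i,j$. A square matrix $(a_{i,j})$ of size $n$ is doubly-symmetric if $a_{i,j}=a_{j,i}=a_{n-j+1,n-i+1}$ for all $i,j$; it is multi-symmetric if it is doubly-symmetric and $a_{i,j}=a_{i,n-j+i+1}$ for all $1\leq i<j\leq n$. -}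

module Defs where

open import Data.Nat using (ℕ; zero; suc; _+_; _*_; _∸_; _≤_; _<_; _/_; _%_)
open import Data.Bool using (Bool; false; _xor_)
open import Data.Product using (_×_)
open import Relation.Binary.PropositionalEquality using (_≡_)

-- A square matrix with entries in 𝔽₂ = Bool (addition = xor), indexed
-- 1-based by naturals; only the entries a i j with 1 ≤ i, j ≤ n matter
-- for a matrix of size n.
Matrix : Set
Matrix = ℕ → ℕ → Bool

IsSteinhaus : ℕ → Matrix → Set
IsSteinhaus n a =
  (∀ i → 1 ≤ i → i ≤ n → a i i ≡ false) ×
  (∀ i j → 2 ≤ i → i < j → j ≤ n →
     a i j ≡ (a (i ∸ 1) (j ∸ 1) xor a (i ∸ 1) j)) ×
  (∀ i j → 1 ≤ i → i ≤ n → 1 ≤ j → j ≤ n → a i j ≡ a j i)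

IsDoublySymmetric : ℕ → Matrix → Set
IsDoublySymmetric n a =
  ∀ i j → 1 ≤ i → i ≤ n → 1 ≤ j → j ≤ n →
    (a i j ≡ a j i) × (a j i ≡ a (n ∸ j + 1) (n ∸ i + 1))

IsMultiSymmetric : ℕ → Matrix → Set
IsMultiSymmetric n a =
  IsDoublySymmetric n a ×
  (∀ i j → 1 ≤ i → i < j → j ≤ n → a i j ≡ a i (n ∸ j + i + 1))

IsMSSteinhaus : ℕ → Matrix → Set
IsMSSteinhaus n a = IsSteinhaus n a × IsMultiSymmetric n a

AdmissibleChoice : ℕ → (ℕ → ℕ) → Set
AdmissibleChoice n j =
  ∀ i → 1 ≤ i → i ≤ (n ∸ 1) / 3 → (2 * i + 1 ≤ j i) × (j i ≤ n ∸ i)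

ceil6 : ℕ → ℕ
ceil6 m = (m + 5) / 6

-- a and b agree on the entries listed in the proposition.
-- For n odd, ⌈(n-3)/6⌉ is computed as ceil6 (n ∸ 3); this is correct
-- also for n = 1 (true value ⌈-1/3⌉ = 0).
AgreeOnData : ℕ → (ℕ → ℕ) → Matrix → Matrix → Set
AgreeOnData n j a b with n % 2
... | zero =
  (a 1 (j 1) ≡ b 1 (j 1)) ×
  (∀ i → 1 ≤ i → i < ceil6 n → a (2 * i) (j (2 * i)) ≡ b (2 * i) (j (2 * i)))
... | suc _ =
  ∀ i → i < ceil6 (n ∸ 3) →
    a (2 * i + 1) (j (2 * i + 1)) ≡ b (2 * i + 1) (j (2 * i + 1))

-- The difference M = a xor b of two multi-symmetric Steinhaus matrices obeys the same local
-- rule and the same symmetries, so it suffices to show that M vanishes above the diagonal.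
-- We peel the upper triangle into layers: layer e consists of row e+1, column n-e and the
-- diagonal j = i+e+1, and these three sides are exchanged by the symmetries.  If M vanishes
-- strictly inside layer e, the local rule makes the top row of layer e constant on its
-- interior, and its two end entries are forced to vanish, so one vanishing entry there (one
-- of the given data) kills the whole layer.  If M vanishes strictly inside layer e+1 and the
-- top row of layer e has even length, the interior of the top row of layer e+1 is a constant
-- c by which the top row of layer e changes at each of an odd number of steps, while its two
-- ends agree; hence c = false and layer e+1 vanishes without using any data.  Descending two
-- layers at a time, data are needed only in every second layer, as listed.
module Submission where

open import Defs
open import Algebra.Bundles using (CommutativeRing)
open import Data.Bool using (Bool; true; false; _xor_)
open import Data.Bool.Properties using (xor-same; xor-assoc; xor-identityʳ; xor-∧-commutativeRing)
open import Data.Empty using (⊥-elim)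
open import Data.List using (_∷_; [])
open import Data.Nat using (ℕ; zero; suc; _+_; _*_; _∸_; _≤_; _<_; z≤n; s≤s; _/_; _%_; NonZero)
open import Data.Nat.DivMod using (m*n/n≡m; /-monoˡ-≤)
open import Data.Nat.Properties
open import Data.Nat.Tactic.RingSolver using (solve)
open import Data.Product using (_×_; _,_; proj₁; proj₂; Σ)
open import Data.Sum using (_⊎_; inj₁; inj₂)
open import Relation.Binary.Definitions using (tri<; tri≈; tri>)
open import Relation.Binary.PropositionalEquality
  using (_≡_; _≢_; refl; sym; trans; cong; cong₂; subst; module ≡-Reasoning)
open import Algebra.Properties.CommutativeSemigroup
  (CommutativeRing.+-commutativeSemigroup xor-∧-commutativeRing) using (interchange)

-- trans with its arguments flipped: the ring solver needs both sides of its equation to be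
-- known when it runs, so the hypothesis fixing the middle term has to be elaborated first.
≡-via : ∀ {A : Set} {x y z : A} → y ≡ z → x ≡ y → x ≡ z
≡-via y≡z x≡y = trans x≡y y≡z

+≡⇒≤ : ∀ {m n} k → m + k ≡ n → m ≤ n
+≡⇒≤ {m} k refl = m≤m+n m k

m+n≡o⇒n≡o∸m : ∀ m n o → m + n ≡ o → n ≡ o ∸ m
m+n≡o⇒n≡o∸m m n o h = trans (sym (m+n∸m≡n m n)) (cong (_∸ m) h)

∸-shift : ∀ {X j j′ c} → j ≤ X → j + j′ ≡ X + c → X ∸ j + c ≡ j′
∸-shift {X} {j} {j′} {c} j≤X h = +-cancelˡ-≡ j _ _ (begin
  j + (X ∸ j + c)  ≡⟨ sym (+-assoc j (X ∸ j) c) ⟩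
  j + (X ∸ j) + c  ≡⟨ cong (_+ c) (m+[n∸m]≡n j≤X) ⟩
  X + c            ≡⟨ sym h ⟩
  j + j′           ∎)
  where open ≡-Reasoning

*≤⇒≤/ : ∀ q x d .{{_ : NonZero d}} → q * d ≤ x → q ≤ x / d
*≤⇒≤/ q x d h = subst (_≤ x / d) (m*n/n≡m q d) (/-monoˡ-≤ d h)

even-or-odd : ∀ n → Σ ℕ λ m → (m + m ≡ n) ⊎ (suc (m + m) ≡ n)
even-or-odd zero = 0 , inj₁ refl
even-or-odd (suc n) with even-or-odd n
... | m , inj₁ e = m , inj₂ (cong suc e)
... | m , inj₂ e = suc m , inj₁ (cong suc (trans (+-suc m m) e))

odd≢even : ∀ m n → suc (m + m) ≢ n + n
odd≢even m n h = even≢odd n m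
  (trans (cong (n +_) (+-identityʳ n)) (trans (sym h) (cong (λ k → suc (m + k)) (sym (+-identityʳ m)))))

[m+m]%2≡0 : ∀ m → (m + m) % 2 ≡ 0
[m+m]%2≡0 zero = refl
[m+m]%2≡0 (suc m) rewrite +-suc m m = [m+m]%2≡0 m

[1+m+m]%2≡1 : ∀ m → suc (m + m) % 2 ≡ 1
[1+m+m]%2≡1 zero = refl
[1+m+m]%2≡1 (suc m) rewrite +-suc m m = [1+m+m]%2≡1 m

xor≡false⇒≡ : ∀ x y → x xor y ≡ false → x ≡ y
xor≡false⇒≡ false false _ = refl
xor≡false⇒≡ true  true  _ = refl

xor≡ˡ⇒false : ∀ x y → x xor y ≡ x → y ≡ false
xor≡ˡ⇒false false false _ = refl
xor≡ˡ⇒false true  false _ = refl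

xor≡⇒≡xor : ∀ x y c → x xor y ≡ c → y ≡ x xor c
xor≡⇒≡xor false y c h = h
xor≡⇒≡xor true false true  _ = refl
xor≡⇒≡xor true true  false _ = refl

xor-twice : ∀ x c → (x xor c) xor c ≡ x
xor-twice x c = trans (xor-assoc x c c) (trans (cong (x xor_) (xor-same c)) (xor-identityʳ x))

odd-steps-of-xor : ∀ (g : ℕ → Bool) c t → (∀ m → m ≤ t + t → g (suc m) ≡ g m xor c) →
  g (suc (t + t)) ≡ g 0 xor c
odd-steps-of-xor g c zero step = step 0 z≤n
odd-steps-of-xor g c (suc t) step = begin
  g (suc (suc t + suc t))          ≡⟨ cong (λ k → g (suc (suc k))) (+-suc t t) ⟩
  g (suc (suc (suc (t + t))))      ≡⟨ step _ (s≤s (≤-reflexive (sym (+-suc t t)))) ⟩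
  g (suc (suc (t + t))) xor c      ≡⟨ cong (_xor c) (step _ (s≤s (+-monoʳ-≤ t (n≤1+n t)))) ⟩
  (g (suc (t + t)) xor c) xor c    ≡⟨ xor-twice _ c ⟩
  g (suc (t + t))                  ≡⟨ odd-steps-of-xor g c t (λ m m≤ → step m (≤-trans m≤ (t+t≤[1+t]+[1+t]))) ⟩
  g 0 xor c                        ∎
  where
  open ≡-Reasoning
  t+t≤[1+t]+[1+t] : t + t ≤ suc t + suc t
  t+t≤[1+t]+[1+t] = +-mono-≤ (n≤1+n t) (n≤1+n t)

module Layers (n : ℕ) (M : Matrix)
  (local-rule : ∀ i j → 2 ≤ i → i < j → j ≤ n → M i j ≡ (M (i ∸ 1) (j ∸ 1) xor M (i ∸ 1) j))
  (row-reversal : ∀ i j → 1 ≤ i → i < j → j ≤ n → M i j ≡ M i (n ∸ j + i + 1))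
  (anti-transpose : ∀ i j → 1 ≤ i → i ≤ n → 1 ≤ j → j ≤ n → M i j ≡ M (n ∸ j + 1) (n ∸ i + 1))
  where

  -- The primed forms take n as any X ≡ n, so that their index conditions can be discharged
  -- by the ring solver against whatever sum the caller knows n to be.

  row-reversal′ : ∀ {X} → X ≡ n → ∀ i j j′ → 1 ≤ i → i < j → j ≤ X → j + j′ ≡ X + (i + 1) →
    M i j ≡ M i j′
  row-reversal′ refl i j j′ h1 h2 h3 h4 =
    trans (row-reversal i j h1 h2 h3) (cong (M i) (trans (+-assoc (n ∸ j) i 1) (∸-shift h3 h4)))

  anti-transpose′ : ∀ {X} → X ≡ n → ∀ i j i′ j′ → 1 ≤ i → i ≤ X → 1 ≤ j → j ≤ X →
    j + i′ ≡ X + 1 → i + j′ ≡ X + 1 → M i j ≡ M i′ j′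
  anti-transpose′ refl i j i′ j′ h1 h2 h3 h4 h5 h6 =
    trans (anti-transpose i j h1 h2 h3 h4) (cong₂ M (∸-shift h4 h5) (∸-shift h2 h6))

  local-rule′ : ∀ {X} → X ≡ n → ∀ i j → 1 ≤ i → suc i < suc j → suc j ≤ X →
    M (suc i) (suc j) ≡ (M i j xor M i (suc j))
  local-rule′ refl i j h1 h2 h3 = local-rule (suc i) (suc j) (s≤s h1) h2 h3

  -- M vanishes on layers e, e+1, …, where layer e is formed by row e+1, column n-e and
  -- the diagonal j = i+e+1; its top row runs from column 2e+2 to column n-e.
  InnerZero : ℕ → Set
  InnerZero e = ∀ i j → suc e ≤ i → suc (i + e) ≤ j → j + e ≤ n → M i j ≡ false

  TopRowZero : ℕ → Set
  TopRowZero e = ∀ j → suc (suc (e + e)) ≤ j → j + e ≤ n → M (suc e) j ≡ false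

  TopRowInteriorZero : ℕ → Set
  TopRowInteriorZero e = ∀ j → suc (suc (suc (e + e))) ≤ j → suc (j + e) ≤ n → M (suc e) j ≡ false

  TopRowDatum : ℕ → Set
  TopRowDatum e = Σ ℕ λ j → suc (suc (suc (e + e))) ≤ j × suc (j + e) ≤ n × M (suc e) j ≡ false

  right-column-zero : ∀ e → TopRowZero e → ∀ p s → suc (suc e + p + e) + s + e ≡ n →
    M (suc e + p) (suc (suc e + p + e) + s) ≡ false
  right-column-zero e top p s hn =
    trans (anti-transpose′ hn (suc e + p) (suc (suc e + p + e) + s) (suc e) (suc (suc (e + e)) + s)
             (+≡⇒≤ (e + p) refl) (+≡⇒≤ (suc (e + s + e)) (solve (e ∷ p ∷ s ∷ [])))
             (+≡⇒≤ (suc (e + p + e + s)) refl) (+≡⇒≤ e refl)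
             (solve (e ∷ p ∷ s ∷ [])) (solve (e ∷ p ∷ s ∷ [])))
          (top (suc (suc (e + e)) + s) (+≡⇒≤ s refl) (+≡⇒≤ p (≡-via hn (solve (e ∷ p ∷ s ∷ [])))))

  -- Row reversal carries the superdiagonal of layer e to its right column, and the
  -- anti-transposition carries the right column to the top row.
  inner-zero-extend : ∀ e → InnerZero (suc e) → TopRowZero e → InnerZero e
  inner-zero-extend e inner top i j h1 h2 h3
    with m≤n⇒∃[o]m+o≡n h1 | m≤n⇒∃[o]m+o≡n h2 | m≤n⇒∃[o]m+o≡n h3
  ... | p , refl | q , refl | r , hr = go p q r hr
    where
    go : ∀ p q r → suc (suc e + p + e) + q + e + r ≡ n →
      M (suc e + p) (suc (suc e + p + e) + q) ≡ false
    go zero q r hr =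
      trans (cong₂ M (+-identityʳ (suc e)) (cong (λ k → suc (suc (k + e)) + q) (+-identityʳ e)))
            (top (suc (suc (e + e)) + q) (+≡⇒≤ q refl) (+≡⇒≤ r (≡-via hr (solve (e ∷ q ∷ r ∷ [])))))
    go (suc p) zero r hr =
      trans (row-reversal′ hr (suc e + suc p) (suc (suc e + suc p + e) + 0) (suc (suc e + suc p + e) + r)
               (+≡⇒≤ (e + suc p) refl) (+≡⇒≤ e (solve (e ∷ p ∷ [])))
               (+≡⇒≤ (e + r) (solve (e ∷ p ∷ r ∷ []))) (solve (e ∷ p ∷ r ∷ [])))
            (right-column-zero e top (suc p) r (≡-via hr (solve (e ∷ p ∷ r ∷ []))))
    go (suc p) (suc q) zero hr = right-column-zero e top (suc p) (suc q) (≡-via hr (solve (e ∷ p ∷ q ∷ [])))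
    go (suc p) (suc q) (suc r) hr =
      inner (suc e + suc p) (suc (suc e + suc p + e) + suc q) (+≡⇒≤ p (solve (e ∷ p ∷ [])))
        (+≡⇒≤ q (solve (e ∷ p ∷ q ∷ []))) (+≡⇒≤ r (≡-via hr (solve (e ∷ p ∷ q ∷ r ∷ []))))

  -- The local rule and the anti-transposition give two expressions for M (e+2) (n-e).
  top-row-last-zero : ∀ e k → suc (suc (suc e)) + k + e ≡ n → M (suc e) (suc (suc (suc e)) + k) ≡ false
  top-row-last-zero e k hn =
    xor≡ˡ⇒false (M (suc e) (suc (suc (e + k)))) (M (suc e) (suc (suc (suc e)) + k))
      (trans (sym by-local-rule) by-anti-transpose)
    where
    by-local-rule : M (suc (suc e)) (suc (suc (suc (e + k)))) ≡
                    (M (suc e) (suc (suc (e + k))) xor M (suc e) (suc (suc (suc (e + k)))))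
    by-local-rule = local-rule′ hn (suc e) (suc (suc (e + k))) (+≡⇒≤ e refl) (+≡⇒≤ k (solve (e ∷ k ∷ [])))
                      (+≡⇒≤ e refl)
    by-anti-transpose : M (suc (suc e)) (suc (suc (suc e)) + k) ≡ M (suc e) (suc (suc (e + k)))
    by-anti-transpose = anti-transpose′ hn (suc (suc e)) (suc (suc (suc e)) + k) (suc e) (suc (suc (e + k)))
                          (+≡⇒≤ (suc e) refl) (+≡⇒≤ (suc k + e) (solve (e ∷ k ∷ [])))
                          (+≡⇒≤ (suc (suc (e + k))) refl) (+≡⇒≤ e refl)
                          (solve (e ∷ k ∷ [])) (solve (e ∷ k ∷ []))

  top-row-first-zero : ∀ e k → suc (suc (suc e)) + k + e ≡ n → M (suc e) (suc (suc (e + e))) ≡ false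
  top-row-first-zero e k hn =
    trans (row-reversal′ hn (suc e) (suc (suc (e + e))) (suc (suc (suc e)) + k)
             (+≡⇒≤ e refl) (+≡⇒≤ e (solve (e ∷ []))) (+≡⇒≤ (suc k) (solve (e ∷ k ∷ [])))
             (solve (e ∷ k ∷ [])))
          (top-row-last-zero e k hn)

  top-row-zero : ∀ e k → suc (suc (suc e)) + k + e ≡ n → TopRowInteriorZero e → TopRowZero e
  top-row-zero e k hn interior j h1 h2 with m≤n⇒∃[o]m+o≡n h1 | m≤n⇒∃[o]m+o≡n h2
  ... | s , refl | r , hr = go s r hr
    where
    go : ∀ s r → suc (suc (e + e)) + s + e + r ≡ n → M (suc e) (suc (suc (e + e)) + s) ≡ false
    go zero r hr = trans (cong (M (suc e)) (+-identityʳ _)) (top-row-first-zero e k hn)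
    go (suc s) zero hr =
      trans (cong (λ k → M (suc e) (suc (suc k))) (trans (+-suc (e + e) s) (cong suc (+-assoc e e s))))
            (top-row-last-zero e (e + s) (≡-via hr (solve (e ∷ s ∷ []))))
    go (suc s) (suc r) hr =
      interior (suc (suc (e + e)) + suc s) (+≡⇒≤ s (solve (e ∷ s ∷ [])))
        (+≡⇒≤ r (≡-via hr (solve (e ∷ s ∷ r ∷ []))))

  top-row-interior-step : ∀ e → InnerZero (suc e) → ∀ j → suc (suc (suc (e + e))) ≤ j →
    suc (suc (j + e)) ≤ n → M (suc e) j ≡ M (suc e) (suc j)
  top-row-interior-step e inner j h1 h2 with m≤n⇒∃[o]m+o≡n h1 | m≤n⇒∃[o]m+o≡n h2
  ... | p , refl | r , hr = xor≡false⇒≡ _ _ (trans (sym below) below-zero)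
    where
    below-zero : M (suc (suc e)) (suc (suc (suc (suc (e + e))) + p)) ≡ false
    below-zero = inner (suc (suc e)) (suc (suc (suc (suc (e + e))) + p)) (+≡⇒≤ 0 (solve (e ∷ [])))
                   (+≡⇒≤ p (solve (e ∷ p ∷ []))) (+≡⇒≤ r (≡-via hr (solve (e ∷ p ∷ r ∷ []))))
    below : M (suc (suc e)) (suc (suc (suc (suc (e + e))) + p)) ≡
            (M (suc e) (suc (suc (suc (e + e))) + p) xor M (suc e) (suc (suc (suc (suc (e + e))) + p)))
    below = local-rule′ hr (suc e) (suc (suc (suc (e + e))) + p) (+≡⇒≤ e refl)
              (+≡⇒≤ (suc (e + p)) (solve (e ∷ p ∷ []))) (+≡⇒≤ (suc e + r) (solve (e ∷ p ∷ r ∷ [])))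

  top-row-interior-constant : ∀ e → InnerZero (suc e) → ∀ k → suc (suc (suc (suc (e + e))) + k + e) ≤ n →
    M (suc e) (suc (suc (suc (e + e))) + k) ≡ M (suc e) (suc (suc (suc (e + e))))
  top-row-interior-constant e inner zero h = cong (M (suc e)) (+-identityʳ _)
  top-row-interior-constant e inner (suc k) h with m≤n⇒∃[o]m+o≡n h
  ... | r , hr = trans (sym (trans (top-row-interior-step e inner (suc (suc (suc (e + e))) + k) (+≡⇒≤ k refl)
                                      (+≡⇒≤ r (≡-via hr (solve (e ∷ k ∷ r ∷ [])))))
                                   (cong (M (suc e)) (solve (e ∷ k ∷ [])))))
                       (top-row-interior-constant e inner k (+≡⇒≤ (suc r) (≡-via hr (solve (e ∷ k ∷ r ∷ [])))))

  top-row-interior-zero : ∀ e → InnerZero (suc e) → TopRowDatum e → TopRowInteriorZero e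
  top-row-interior-zero e inner (j₀ , j₀-lo , j₀-hi , j₀-zero) j h1 h2
    with m≤n⇒∃[o]m+o≡n h1 | m≤n⇒∃[o]m+o≡n j₀-lo
  ... | p , refl | q , refl =
    trans (top-row-interior-constant e inner p h2)
          (trans (sym (top-row-interior-constant e inner q j₀-hi)) j₀-zero)

  top-row-interior-zero-vacuous : ∀ e s → n + s ≡ e + e + e + 3 → TopRowInteriorZero e
  top-row-interior-zero-vacuous e s hn j h1 h2 with m≤n⇒∃[o]m+o≡n h1 | m≤n⇒∃[o]m+o≡n h2
  ... | p , refl | r , hr = ⊥-elim (m+1+n≢m (e + e + e + 3) {p + r + s}
      (trans (sym (trans (cong (_+ s) (sym hr)) (solve (e ∷ p ∷ r ∷ s ∷ [])))) hn))

  inner-zero-vacuous : ∀ e s → n + s ≡ e + e + e + 1 → InnerZero e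
  inner-zero-vacuous e s hn i j h1 h2 h3
    with m≤n⇒∃[o]m+o≡n h1 | m≤n⇒∃[o]m+o≡n h2 | m≤n⇒∃[o]m+o≡n h3
  ... | p , refl | q , refl | r , hr = ⊥-elim (m+1+n≢m (e + e + e + 1) {p + q + r + s}
      (trans (sym (trans (cong (_+ s) (sym hr)) (solve (e ∷ p ∷ q ∷ r ∷ s ∷ [])))) hn))

  -- The interior of row e+2 is a constant c, and each of its entries is the xor of two
  -- neighbours in row e+1, so row e+1 changes by c at each of an odd number of steps.  But
  -- the ends of that stretch agree, by the row reversal and the vanishing end entries of
  -- row e+2; hence c = false.
  top-row-interior-zero-by-parity : ∀ e t → InnerZero (suc (suc e)) →
    e + e + e + (suc t + suc t + 5) ≡ n → TopRowInteriorZero (suc e)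
  top-row-interior-zero-by-parity e t inner hn j h1 h2 with m≤n⇒∃[o]m+o≡n h1
  ... | p , refl = trans (top-row-interior-constant (suc e) inner p h2) c≡false
    where
    f : ℕ → Bool
    f = M (suc e)
    g : ℕ → Bool
    g m = f (suc (suc (suc (suc (e + e)))) + m)
    c : Bool
    c = M (suc (suc e)) (suc (suc (suc (suc e + suc e))))

    first-pair : f (suc (suc (suc (e + e)))) ≡ g 0
    first-pair =
      trans (xor≡false⇒≡ _ _ (trans (sym rule) (≡-via first-zero (cong (M (suc (suc e))) (solve (e ∷ []))))))
                       (cong f (sym (+-identityʳ _)))
      where
      first-zero : M (suc (suc e)) (suc (suc (suc e + suc e))) ≡ false
      first-zero = top-row-first-zero (suc e) (suc (suc (e + (t + t)))) (≡-via hn (solve (e ∷ t ∷ [])))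
      rule : M (suc (suc e)) (suc (suc (suc (suc (e + e))))) ≡
             (f (suc (suc (suc (e + e)))) xor f (suc (suc (suc (suc (e + e))))))
      rule = local-rule′ hn (suc e) (suc (suc (suc (e + e)))) (+≡⇒≤ e refl) (+≡⇒≤ (suc e) (solve (e ∷ [])))
               (+≡⇒≤ (suc (suc (suc (e + (t + t))))) (solve (e ∷ t ∷ [])))

    last-pair : g (suc (t + t)) ≡ g (suc (suc (t + t)))
    last-pair =
      trans (xor≡false⇒≡ _ _ (trans (sym rule) (≡-via last-zero (cong (M (suc (suc e))) (solve (e ∷ t ∷ []))))))
                      (cong f (solve (e ∷ t ∷ [])))
      where
      last-zero : M (suc (suc e)) (suc (suc (suc (suc e))) + suc (suc (e + (t + t)))) ≡ false
      last-zero = top-row-last-zero (suc e) (suc (suc (e + (t + t)))) (≡-via hn (solve (e ∷ t ∷ [])))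
      rule : M (suc (suc e)) (suc (suc (suc (suc (suc (e + e)))) + suc (t + t))) ≡
             (g (suc (t + t)) xor f (suc (suc (suc (suc (suc (e + e)))) + suc (t + t))))
      rule = local-rule′ hn (suc e) (suc (suc (suc (suc (e + e)))) + suc (t + t)) (+≡⇒≤ e refl)
               (+≡⇒≤ (suc (suc (suc (e + (t + t))))) (solve (e ∷ t ∷ [])))
               (+≡⇒≤ (suc e) (solve (e ∷ t ∷ [])))

    reversed-ends : f (suc (suc (suc (e + e)))) ≡ g (suc (suc (t + t)))
    reversed-ends =
      row-reversal′ hn (suc e) (suc (suc (suc (e + e)))) (suc (suc (suc (suc (e + e)))) + suc (suc (t + t)))
        (+≡⇒≤ e refl) (+≡⇒≤ (suc e) (solve (e ∷ [])))
        (+≡⇒≤ (suc (suc (suc (suc (e + (t + t)))))) (solve (e ∷ t ∷ []))) (solve (e ∷ t ∷ []))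

    step : ∀ m → m ≤ t + t → g (suc m) ≡ g m xor c
    step m m≤ with m≤n⇒∃[o]m+o≡n m≤
    ... | d , hd = xor≡⇒≡xor (g m) (g (suc m)) c
        (≡-via (trans (sym rule) (≡-via constant (cong (M (suc (suc e))) (solve (e ∷ m ∷ [])))))
               (cong (g m xor_) (cong f (solve (e ∷ m ∷ [])))))
      where
      size : e + e + e + (m + d) + 7 ≡ e + e + e + (suc t + suc t + 5)
      size = trans (cong (λ z → e + e + e + z + 7) hd) (solve (e ∷ t ∷ []))
      rule : M (suc (suc e)) (suc (suc (suc (suc (suc (e + e)))) + m)) ≡
             (g m xor f (suc (suc (suc (suc (suc (e + e)))) + m)))
      rule = local-rule′ hn (suc e) (suc (suc (suc (suc (e + e)))) + m) (+≡⇒≤ e refl)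
               (+≡⇒≤ (suc (suc (e + m))) (solve (e ∷ m ∷ [])))
               (+≡⇒≤ (suc (suc (e + d))) (≡-via size (solve (e ∷ m ∷ d ∷ []))))
      constant : M (suc (suc e)) (suc (suc (suc (suc e + suc e))) + m) ≡ c
      constant = top-row-interior-constant (suc e) inner m
                   (+≡⇒≤ d (≡-via hn (≡-via size (solve (e ∷ m ∷ d ∷ [])))))

    c≡false : c ≡ false
    c≡false = xor≡ˡ⇒false (f (suc (suc (suc (e + e))))) c (sym (begin
      f (suc (suc (suc (e + e))))  ≡⟨ reversed-ends ⟩
      g (suc (suc (t + t)))        ≡⟨ sym last-pair ⟩
      g (suc (t + t))              ≡⟨ odd-steps-of-xor g c t step ⟩
      g 0 xor c                    ≡⟨ cong (_xor c) (sym first-pair) ⟩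
      f (suc (suc (suc (e + e)))) xor c ∎))
      where open ≡-Reasoning

  top-row-zero-by-parity : ∀ e t → InnerZero (suc (suc e)) → e + e + e + (t + t + 5) ≡ n →
    TopRowZero (suc e)
  top-row-zero-by-parity e t inner hn =
    top-row-zero (suc e) (e + (t + t)) (≡-via hn (solve (e ∷ t ∷ []))) (interior t hn)
    where
    interior : ∀ t → e + e + e + (t + t + 5) ≡ n → TopRowInteriorZero (suc e)
    interior zero hn = top-row-interior-zero-vacuous (suc e) 1 (trans (cong (_+ 1) (sym hn)) (solve (e ∷ [])))
    interior (suc t) hn = top-row-interior-zero-by-parity e t inner hn

  module Descent (datum : ∀ e t → e + e + e + (t + t + 5) ≡ n → TopRowDatum e) where

    inner-zero-two-layers : ∀ t e → e + e + e + (t + t + 5) ≡ n → InnerZero (suc (suc e)) → InnerZero e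
    inner-zero-two-layers t e hn inner₂ =
      inner-zero-extend e inner₁
        (top-row-zero e (suc (suc (e + (t + t)))) (≡-via hn (solve (e ∷ t ∷ [])))
          (top-row-interior-zero e inner₁ (datum e t hn)))
      where
      inner₁ : InnerZero (suc e)
      inner₁ = inner-zero-extend (suc e) inner₂ (top-row-zero-by-parity e t inner₂ hn)

    inner-zero : ∀ t e → e + e + e + (t + t + 1) ≡ n → InnerZero e
    inner-zero zero e hn = inner-zero-vacuous e 0 (trans (+-identityʳ n) (sym hn))
    inner-zero (suc zero) e hn =
      inner-zero-extend e (inner-zero-vacuous (suc e) 1 (trans (cong (_+ 1) (sym hn)) (solve (e ∷ []))))
        (top-row-zero e e (≡-via hn (solve (e ∷ [])))
          (top-row-interior-zero-vacuous e 0 (trans (+-identityʳ n) (sym hn))))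
    inner-zero (suc (suc zero)) e hn =
      inner-zero-two-layers 0 e (≡-via hn (solve (e ∷ [])))
        (inner-zero-vacuous (suc (suc e)) 2 (trans (cong (_+ 2) (sym hn)) (solve (e ∷ []))))
    inner-zero (suc (suc (suc t))) e hn =
      inner-zero-two-layers (suc t) e (≡-via hn (solve (e ∷ t ∷ [])))
        (inner-zero t (suc (suc e)) (≡-via hn (solve (e ∷ t ∷ []))))

agreeOnData-even : ∀ n j (a b : Matrix) → n % 2 ≡ 0 → AgreeOnData n j a b →
  (a 1 (j 1) ≡ b 1 (j 1)) ×
  (∀ i → 1 ≤ i → i < ceil6 n → a (2 * i) (j (2 * i)) ≡ b (2 * i) (j (2 * i)))
agreeOnData-even n j a b eq agree with n % 2
agreeOnData-even n j a b refl agree | .0 = agree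

agreeOnData-odd : ∀ n j (a b : Matrix) → n % 2 ≡ 1 → AgreeOnData n j a b →
  ∀ i → i < ceil6 (n ∸ 3) → a (2 * i + 1) (j (2 * i + 1)) ≡ b (2 * i + 1) (j (2 * i + 1))
agreeOnData-odd n j a b eq agree with n % 2
agreeOnData-odd n j a b refl agree | .1 = agree

module Difference (n : ℕ) (j : ℕ → ℕ) (adm : AdmissibleChoice n j) (a b : Matrix)
  (ha : IsMSSteinhaus n a) (hb : IsMSSteinhaus n b) where

  M : Matrix
  M r s = a r s xor b r s

  local-rule : ∀ i k → 2 ≤ i → i < k → k ≤ n → M i k ≡ (M (i ∸ 1) (k ∸ 1) xor M (i ∸ 1) k)
  local-rule i k h1 h2 h3 =
    trans (cong₂ _xor_ (proj₁ (proj₂ (proj₁ ha)) i k h1 h2 h3) (proj₁ (proj₂ (proj₁ hb)) i k h1 h2 h3))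
          (interchange (a (i ∸ 1) (k ∸ 1)) (a (i ∸ 1) k) (b (i ∸ 1) (k ∸ 1)) (b (i ∸ 1) k))

  row-reversal : ∀ i k → 1 ≤ i → i < k → k ≤ n → M i k ≡ M i (n ∸ k + i + 1)
  row-reversal i k h1 h2 h3 = cong₂ _xor_ (proj₂ (proj₂ ha) i k h1 h2 h3) (proj₂ (proj₂ hb) i k h1 h2 h3)

  anti-transpose : ∀ i k → 1 ≤ i → i ≤ n → 1 ≤ k → k ≤ n → M i k ≡ M (n ∸ k + 1) (n ∸ i + 1)
  anti-transpose i k h1 h2 h3 h4 =
    cong₂ _xor_ (trans (proj₁ doubly-a) (proj₂ doubly-a)) (trans (proj₁ doubly-b) (proj₂ doubly-b))
    where
    doubly-a : (a i k ≡ a k i) × (a k i ≡ a (n ∸ k + 1) (n ∸ i + 1))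
    doubly-a = proj₁ (proj₂ ha) i k h1 h2 h3 h4
    doubly-b : (b i k ≡ b k i) × (b k i ≡ b (n ∸ k + 1) (n ∸ i + 1))
    doubly-b = proj₁ (proj₂ hb) i k h1 h2 h3 h4

  open Layers n M local-rule row-reversal anti-transpose public

  agreement-zero : ∀ {r s} → a r s ≡ b r s → M r s ≡ false
  agreement-zero {r} {s} e = trans (cong (a r s xor_) (sym e)) (xor-same (a r s))

  admissible-datum : ∀ e ℓ k → ℓ ≡ suc e → e + e + e + (k + 4) ≡ n → a ℓ (j ℓ) ≡ b ℓ (j ℓ) →
    TopRowDatum e
  admissible-datum e ℓ k refl hn agree =
    j (suc e) , ≤-trans {j = 2 * suc e + 1} (≤-reflexive (solve (e ∷ []))) (proj₁ bounds) ,
    fits , agreement-zero agree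
    where
    in-range : suc e ≤ (n ∸ 1) / 3
    in-range = *≤⇒≤/ (suc e) (n ∸ 1) 3 (+≡⇒≤ k
      (≡-via (m+n≡o⇒n≡o∸m 1 (e + e + e + (k + 3)) n (≡-via hn (solve (e ∷ k ∷ [])))) (solve (e ∷ k ∷ []))))
    bounds : (2 * suc e + 1 ≤ j (suc e)) × (j (suc e) ≤ n ∸ suc e)
    bounds = adm (suc e) (s≤s z≤n) in-range
    fits : suc (j (suc e) + e) ≤ n
    fits = subst (_≤ n) (+-suc (j (suc e)) e)
             (≤-trans (+-monoˡ-≤ (suc e) (proj₂ bounds))
               (≤-reflexive (m∸n+n≡m {n} {suc e} (+≡⇒≤ (e + e + (k + 3)) (≡-via hn (solve (e ∷ k ∷ [])))))))

  inner-zero-even : ∀ t → suc (suc t) + suc (suc t) ≡ n → a 1 (j 1) ≡ b 1 (j 1) →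
    (∀ i → 1 ≤ i → i < ceil6 n → a (2 * i) (j (2 * i)) ≡ b (2 * i) (j (2 * i))) → InnerZero 0
  inner-zero-even t hn agree₁ agree₂ =
    inner-zero-extend 0 inner₁
      (top-row-zero 0 (suc (t + t)) (≡-via hn (solve (t ∷ [])))
        (top-row-interior-zero 0 inner₁ (admissible-datum 0 1 (t + t) refl (≡-via hn (solve (t ∷ []))) agree₁)))
    where
    -- The descent asks for data only in layers e with n - 3e odd, here e = 2i+1 (row 2i+2).
    datum : ∀ e t′ → e + e + e + (t′ + t′ + 5) ≡ n → TopRowDatum e
    datum e t′ he with even-or-odd e
    ... | i , inj₁ refl =
      ⊥-elim (odd≢even (i + i + i + t′ + 2) (suc (suc t)) (≡-via (trans he (sym hn)) (solve (i ∷ t′ ∷ []))))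
    ... | i , inj₂ refl =
      admissible-datum (suc (i + i)) (2 * suc i) (t′ + t′ + 1) (solve (i ∷ [])) (≡-via he (solve (i ∷ t′ ∷ [])))
        (agree₂ (suc i) (s≤s z≤n)
          (*≤⇒≤/ (suc (suc i)) (n + 5) 6 (+≡⇒≤ (t′ + t′ + 1) (≡-via (cong (_+ 5) he) (solve (i ∷ t′ ∷ []))))))
    inner₁ : InnerZero 1
    inner₁ = Descent.inner-zero datum t 1 (≡-via hn (solve (t ∷ [])))

  inner-zero-odd : ∀ m → suc (m + m) ≡ n →
    (∀ i → i < ceil6 (n ∸ 3) → a (2 * i + 1) (j (2 * i + 1)) ≡ b (2 * i + 1) (j (2 * i + 1))) → InnerZero 0
  inner-zero-odd m hn agree = Descent.inner-zero datum m 0 (≡-via hn (solve (m ∷ [])))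
    where
    -- Here the layers e with n - 3e odd are e = 2i (row 2i+1).
    datum : ∀ e t′ → e + e + e + (t′ + t′ + 5) ≡ n → TopRowDatum e
    datum e t′ he with even-or-odd e
    ... | i , inj₂ refl =
      ⊥-elim (odd≢even m (i + i + i + t′ + 4) (trans hn (trans (sym he) (solve (i ∷ t′ ∷ [])))))
    ... | i , inj₁ refl =
      admissible-datum (i + i) (2 * i + 1) (t′ + t′ + 1) (solve (i ∷ [])) (≡-via he (solve (i ∷ t′ ∷ [])))
        (agree i (*≤⇒≤/ (suc i) (n ∸ 3 + 5) 6 (+≡⇒≤ (t′ + t′ + 1)
          (≡-via (cong (_+ 5) (m+n≡o⇒n≡o∸m 3 (i + i + (i + i) + (i + i) + (t′ + t′ + 2)) n
                                 (≡-via he (solve (i ∷ t′ ∷ [])))))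
                 (solve (i ∷ t′ ∷ []))))))

  inner-zero-from-data : 1 ≤ n → n ≢ 2 → AgreeOnData n j a b → InnerZero 0
  inner-zero-from-data 1≤n n≢2 agree with even-or-odd n
  ... | zero , inj₁ refl = ⊥-elim (n≮0 1≤n)
  ... | suc zero , inj₁ refl = ⊥-elim (n≢2 refl)
  ... | suc (suc t) , inj₁ hn =
    let agree₁ , agree₂ = agreeOnData-even n j a b
                            (trans (cong (_% 2) (sym hn)) ([m+m]%2≡0 (suc (suc t)))) agree
    in inner-zero-even t hn agree₁ agree₂
  ... | m , inj₂ hn =
    inner-zero-odd m hn (agreeOnData-odd n j a b (trans (cong (_% 2) (sym hn)) ([1+m+m]%2≡1 m)) agree)

  agreement-above-diagonal : InnerZero 0 → ∀ r s → 1 ≤ r → r < s → s ≤ n → a r s ≡ b r s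
  agreement-above-diagonal inner r s hr r<s hs =
    xor≡false⇒≡ _ _ (inner r s hr (subst (_≤ s) (cong suc (sym (+-identityʳ r))) r<s)
                                  (subst (_≤ n) (sym (+-identityʳ s)) hs))

  agreement-from-inner-zero : InnerZero 0 → ∀ r s → 1 ≤ r → r ≤ n → 1 ≤ s → s ≤ n → a r s ≡ b r s
  agreement-from-inner-zero inner r s hr1 hr2 hs1 hs2 with <-cmp r s
  ... | tri< r<s _ _ = agreement-above-diagonal inner r s hr1 r<s hs2
  ... | tri≈ _ refl _ = trans (proj₁ (proj₁ ha) r hr1 hr2) (sym (proj₁ (proj₁ hb) r hr1 hr2))
  ... | tri> _ _ s<r =
    trans (proj₂ (proj₂ (proj₁ ha)) r s hr1 hr2 hs1 hs2)
      (trans (agreement-above-diagonal inner s r hs1 s<r hr2)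
             (sym (proj₂ (proj₂ (proj₁ hb)) r s hr1 hr2 hs1 hs2)))

proposition5 : (n : ℕ) → 1 ≤ n → n ≢ 2 → (j : ℕ → ℕ) → AdmissibleChoice n j →
    (a b : Matrix) → IsMSSteinhaus n a → IsMSSteinhaus n b →
    AgreeOnData n j a b →
    ∀ r s → 1 ≤ r → r ≤ n → 1 ≤ s → s ≤ n → a r s ≡ b r s
proposition5 n 1≤n n≢2 j adm a b ha hb agree =
  agreement-from-inner-zero (inner-zero-from-data 1≤n n≢2 agree)
  where open Difference n j adm a b ha hb
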